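{- Every internally 1-connected surface-embeddable complex is internally connected.
   Context: A pure 2-dimensional simplicial complex $S$ is surface-embeddable if it is a subcomplex of some triangulated surface. $\partial S$ is the subgraph of $S$ realizing the boundary of $|S|$; vertices of $\partial S$ are boundary vertices, all other vertices are internal; an edge is internal if it contains an internal vertex. $S$ is internally 1-connected if for any two distinct 2-faces $\sigma,\sigma'$ of $S$ there is a sequence of 2-faces $\sigma=\sigma_0,\sigma_1,\dots,\sigma_k=\sigma'$ such that each $\sigma_{i-1}\cap\sigma_i$ is an internal edge of $S$. $S$ is internally connected if the induced subcomplex of $S$ on its internal vertices is connected. -}

module Defs where

open import Data.Nat using (ℕ; _<_)
open import Data.Product using (_×_; _,_; ∃; ∃-syntax)
open import Data.Sum using (_⊎_)
open import Data.List using (List; [])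
open import Data.List.Membership.Propositional using (_∈_)
open import Data.List.Relation.Unary.All using (All)
open import Relation.Binary.PropositionalEquality using (_≡_; _≢_)
open import Relation.Binary.Construct.Closure.ReflexiveTransitive using (Star)

-- Vertices are natural numbers.  A 2-face (triangle) {a,b,c} is stored as
-- the sorted triple (a , b , c) with a < b < c, so that equality of
-- triples is equality of vertex sets.
Tri : Set
Tri = ℕ × ℕ × ℕ

Sorted : Tri → Set
Sorted (a , b , c) = (a < b) × (b < c)

_∈ᵗ_ : ℕ → Tri → Set
v ∈ᵗ (a , b , c) = (v ≡ a) ⊎ (v ≡ b) ⊎ (v ≡ c)

-- A finite pure 2-dimensional simplicial complex, given by its list of
-- 2-faces; its vertices and edges are exactly the faces of these triangles.
record Complex : Set where
  constructor complex
  field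
    faces  : List Tri
    sorted : All Sorted faces
open Complex public

_∈ᶠ_ : Tri → Complex → Set
σ ∈ᶠ S = σ ∈ faces S

IsVertex : Complex → ℕ → Set
IsVertex S v = ∃[ σ ] (σ ∈ᶠ S × v ∈ᵗ σ)

IsEdge : Complex → ℕ → ℕ → Set
IsEdge S u w = (u ≢ w) × ∃[ σ ] (σ ∈ᶠ S × u ∈ᵗ σ × w ∈ᵗ σ)

InExactlyTwoFaces : Complex → ℕ → ℕ → Set
InExactlyTwoFaces S u w =
  ∃[ σ₁ ] ∃[ σ₂ ] (σ₁ ∈ᶠ S × σ₂ ∈ᶠ S × σ₁ ≢ σ₂
    × (u ∈ᵗ σ₁ × w ∈ᵗ σ₁) × (u ∈ᵗ σ₂ × w ∈ᵗ σ₂)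
    × (∀ σ → σ ∈ᶠ S → u ∈ᵗ σ → w ∈ᵗ σ → (σ ≡ σ₁) ⊎ (σ ≡ σ₂)))

LinkAdj : Complex → ℕ → ℕ → ℕ → Set
LinkAdj S v a b =
  (a ≢ b) × (a ≢ v) × (b ≢ v) × ∃[ σ ] (σ ∈ᶠ S × v ∈ᵗ σ × a ∈ᵗ σ × b ∈ᵗ σ)

-- v is an internal (non-boundary) vertex of S: |S| is a 2-manifold near v,
-- i.e. the link of v in S is a cycle: every link vertex has degree 2
-- (each edge at v lies in exactly two 2-faces) and the link is connected.
Internal : Complex → ℕ → Set
Internal S v =
  IsVertex S v
  × (∀ a → IsEdge S v a → InExactlyTwoFaces S v a)
  × (∀ a b → IsEdge S v a → IsEdge S v b → Star (LinkAdj S v) a b)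

IsSurface : Complex → Set
IsSurface T = (faces T ≢ []) × (∀ v → IsVertex T v → Internal T v)

_⊆ᶜ_ : Complex → Complex → Set
S ⊆ᶜ T = ∀ σ → σ ∈ᶠ S → σ ∈ᶠ T

SurfaceEmbeddable : Complex → Set
SurfaceEmbeddable S = ∃[ T ] (IsSurface T × S ⊆ᶜ T)

MeetInInternalEdge : Complex → Tri → Tri → Set
MeetInInternalEdge S σ τ =
  ∃[ u ] ∃[ w ] ((u ≢ w)
    × (u ∈ᵗ σ × u ∈ᵗ τ) × (w ∈ᵗ σ × w ∈ᵗ τ)
    × (∀ x → x ∈ᵗ σ → x ∈ᵗ τ → (x ≡ u) ⊎ (x ≡ w))
    × (Internal S u ⊎ Internal S w))

FaceStep : Complex → Tri → Tri → Set
FaceStep S σ τ = σ ∈ᶠ S × τ ∈ᶠ S × MeetInInternalEdge S σ τ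

InternallyOneConnected : Complex → Set
InternallyOneConnected S =
  ∀ σ σ' → σ ∈ᶠ S → σ' ∈ᶠ S → σ ≢ σ' → Star (FaceStep S) σ σ'

InternalStep : Complex → ℕ → ℕ → Set
InternalStep S u w = Internal S u × Internal S w × IsEdge S u w

InternallyConnected : Complex → Set
InternallyConnected S =
  ∀ u w → Internal S u → Internal S w → Star (InternalStep S) u w

{-# OPTIONS --safe #-}
-- Along a sequence of 2-faces in which consecutive faces meet in an internal
-- edge, choose an internal vertex of each shared edge.  Consecutive choices lie
-- in a common face, so they are equal or adjacent, and together they form a
-- path of internal vertices.
module Submission where

open import Defs
open import Data.Nat using (ℕ; _≟_)
open import Data.Product using (_×_; _,_; ∃-syntax)
open import Data.Product.Properties using (≡-dec)
open import Data.Sum using (inj₁; inj₂)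
open import Relation.Nullary using (Dec; yes; no)
open import Relation.Binary.PropositionalEquality using (_≡_; refl)
open import Relation.Binary.Construct.Closure.ReflexiveTransitive using (Star; ε; _◅_; _◅◅_)

_≟ᵗ_ : (σ τ : Tri) → Dec (σ ≡ τ)
_≟ᵗ_ = ≡-dec _≟_ (≡-dec _≟_ _≟_)

module _ {S : Complex} where

  internal-path-within-face : ∀ {u w σ} → σ ∈ᶠ S → Internal S u → u ∈ᵗ σ →
                              Internal S w → w ∈ᵗ σ → Star (InternalStep S) u w
  internal-path-within-face {u} {w} σ∈S iu u∈σ iw w∈σ with u ≟ w
  ... | yes refl = ε
  ... | no u≢w   = (iu , iw , u≢w , _ , σ∈S , u∈σ , w∈σ) ◅ ε

  shared-internal-vertex : ∀ {σ τ} → MeetInInternalEdge S σ τ →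
                           ∃[ x ] (Internal S x × x ∈ᵗ σ × x ∈ᵗ τ)
  shared-internal-vertex (u , _ , _ , (u∈σ , u∈τ) , _ , _ , inj₁ iu) = u , iu , u∈σ , u∈τ
  shared-internal-vertex (_ , w , _ , _ , (w∈σ , w∈τ) , _ , inj₂ iw) = w , iw , w∈σ , w∈τ

  face-path⇒internal-path : ∀ {σ τ u w} → Star (FaceStep S) σ τ → σ ∈ᶠ S →
                            Internal S u → u ∈ᵗ σ → Internal S w → w ∈ᵗ τ →
                            Star (InternalStep S) u w
  face-path⇒internal-path ε σ∈S iu u∈σ iw w∈σ =
    internal-path-within-face σ∈S iu u∈σ iw w∈σ
  face-path⇒internal-path ((_ , σ₁∈S , meet) ◅ steps) σ∈S iu u∈σ iw w∈τ
    with x , ix , x∈σ , x∈σ₁ ← shared-internal-vertex meet =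
    internal-path-within-face σ∈S iu u∈σ ix x∈σ
      ◅◅ face-path⇒internal-path steps σ₁∈S ix x∈σ₁ iw w∈τ

  face-path : InternallyOneConnected S → ∀ {σ τ} → σ ∈ᶠ S → τ ∈ᶠ S →
              Star (FaceStep S) σ τ
  face-path ioc {σ} {τ} σ∈S τ∈S with σ ≟ᵗ τ
  ... | yes refl = ε
  ... | no σ≢τ   = ioc σ τ σ∈S τ∈S σ≢τ

lemma4p4 : (S : Complex) → SurfaceEmbeddable S → InternallyOneConnected S → InternallyConnected S
lemma4p4 S _ ioc u w iu@((σ , σ∈S , u∈σ) , _) iw@((τ , τ∈S , w∈τ) , _) =
  face-path⇒internal-path {S} (face-path {S} ioc σ∈S τ∈S) σ∈S iu u∈σ iw w∈τ
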